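{- Let $k$ be a positive integer and let $h \geq 2$ be an integer. Put $m = 2^{\lfloor \log_2 h \rfloor + 1}k - 1$ and $n = \binom{m+h-1}{h}$. Then \[\nu(\mathbb{Z}_n, m, h) < \min\left\{n, \binom{m+h-1}{h}\right\}.\]
   Context: $\mathbb{Z}_n$ denotes the additive cyclic group of order $n$, and $\lfloor x \rfloor$ is the greatest integer $\le x$. For a finite subset $A = \{a_1,\dots,a_m\}$ of an additive abelian group $G$ and an integer $h \ge 0$, the $h$-fold sumset is $hA = \{\sum_{i=1}^m \lambda_i a_i : \lambda_i \in \{0,1,\dots,h\},\ \sum_{i=1}^m \lambda_i = h\}$. For positive integers $m,h$, $\nu(G,m,h) = \max\{|hA| : A \subseteq G,\ |A| = m\}$. -}

module Defs where

open import Data.Nat using (ℕ; _+_; _*_; _≤_)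
open import Data.Fin using (Fin; toℕ)
open import Data.Fin.Subset using (Subset; _∈_; ∣_∣)
open import Data.List using (map; allFin)
open import Data.Nat.ListAction using (sum)
open import Data.Sum using (_⊎_)
open import Data.Product using (Σ; _×_; ∃)
open import Function.Bundles using (_⇔_)
open import Relation.Binary.PropositionalEquality using (_≡_)

-- The cyclic group ℤ_n is modelled by Fin n (residues 0,…,n-1);
-- a subset A ⊆ ℤ_n is a 'Subset n' and |A| is '∣ A ∣'.

_≡_[mod_] : ℕ → ℕ → ℕ → Set
a ≡ b [mod n ] = ∃ λ q → a ≡ b + q * n

-- x ∈ hA :  x = Σ_{a ∈ A} λ_a · a  in ℤ_n, with λ_a ∈ ℕ, Σ λ_a = h
-- (λ vanishes outside A; λ_a ≤ h is automatic from Σ λ_a = h).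
InSumset : (n h : ℕ) → Subset n → Fin n → Set
InSumset n h A x =
  Σ (Fin n → ℕ) λ coeff →
      (∀ i → coeff i ≡ 0 ⊎ i ∈ A)
    × (sum (map coeff (allFin n)) ≡ h)
    × (sum (map (λ i → coeff i * toℕ i) (allFin n)) ≡ toℕ x [mod n ])

SumsetSize : (n h : ℕ) → Subset n → ℕ → Set
SumsetSize n h A s =
  Σ (Subset n) λ S → (∀ x → (x ∈ S) ⇔ InSumset n h A x) × (∣ S ∣ ≡ s)

IsNu : (n m h v : ℕ) → Set
IsNu n m h v =
    (Σ (Subset n) λ A → (∣ A ∣ ≡ m) × SumsetSize n h A v)
  × (∀ (A : Subset n) (s : ℕ) → ∣ A ∣ ≡ m → SumsetSize n h A s → s ≤ v)

module Submission where

-- Write n = C(m+h−1, h), the number of h-element multisets drawn from an m-set. As m + 1 = 2^(t+1) k and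
-- 2 ≤ h < 2^(t+1), n is even: modulo 2, (1 − x)^(−(m+1)) ≡ (1 − x^(2^(t+1)))^(−k), so its coefficients of
-- x^(h−1) and x^h are even, and n is their difference.
-- If |A| = m and hA = ℤ_n, the n multiset sums (elements of A read as integers in [0, n)) hit every residue
-- exactly once; n being even, exactly half of these sums are even, so Σ (−1)^sum vanishes. But that signed
-- count is the coefficient of x^h in (1 − x)^(−e) (1 + x)^(−o), where e and o count the even and the odd
-- elements of A, and e + o = m is odd. For e > o this series is (1 − x)^(−(e−o)) (1 − x²)^(−o), with positive
-- coefficients, and x ↦ −x exchanges e and o; so the coefficient is nonzero and |hA| < n for every m-subset A.

open import Defs

module Arithmetic where

  open import Data.Nat using (zero; suc; _+_; _*_; _^_; _≤_; _<_; z≤n; s≤s; ⌊_/2⌋)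
  open import Data.Nat.Properties
  open import Data.Nat.Combinatorics using (_C_; nC1≡n; nCk+nC[k+1]≡[n+1]C[k+1])
  open import Data.Nat.Logarithm.Core using (⌊log2⌋)
  open import Induction.WellFounded using (Acc; acc)
  open import Relation.Binary.PropositionalEquality

  n≤1+2⌊n/2⌋ : ∀ n → n ≤ suc (2 * ⌊ n /2⌋)
  n≤1+2⌊n/2⌋ zero = z≤n
  n≤1+2⌊n/2⌋ (suc zero) = s≤s z≤n
  n≤1+2⌊n/2⌋ (suc (suc n)) =
    subst (suc (suc n) ≤_) (sym (cong suc (*-suc 2 ⌊ n /2⌋))) (s≤s (s≤s (n≤1+2⌊n/2⌋ n)))

  <2^[1+⌊log2⌋] : ∀ n (rec : Acc _<_ n) → n < 2 ^ suc (⌊log2⌋ n rec)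
  <2^[1+⌊log2⌋] zero _ = s≤s z≤n
  <2^[1+⌊log2⌋] (suc zero) _ = s≤s (s≤s z≤n)
  <2^[1+⌊log2⌋] (suc (suc n)) (acc rs) = begin-strict
    suc (suc n)                           ≤⟨ s≤s (s≤s (n≤1+2⌊n/2⌋ n)) ⟩
    3 + 2 * m                             <⟨ n<1+n _ ⟩
    4 + 2 * m                             ≡⟨ sym (trans (*-suc 2 (suc m)) (cong (_+_ 2) (*-suc 2 m))) ⟩
    2 * suc (suc m)                       ≤⟨ *-monoʳ-≤ 2 (<2^[1+⌊log2⌋] (suc m) _) ⟩
    2 * 2 ^ suc (⌊log2⌋ (suc m) _)        ∎
    where
      open ≤-Reasoning
      m = ⌊ n /2⌋

  ≤-binomial : ∀ m h → m ≤ (m + h) C suc h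
  ≤-binomial m zero = ≤-reflexive (sym (trans (cong (_C 1) (+-identityʳ m)) (nC1≡n m)))
  ≤-binomial m (suc h) = begin
    m                                              ≤⟨ ≤-binomial m h ⟩
    (m + h) C suc h                                ≤⟨ m≤m+n _ _ ⟩
    (m + h) C suc h + (m + h) C suc (suc h)        ≡⟨ nCk+nC[k+1]≡[n+1]C[k+1] (m + h) (suc h) ⟩
    suc (m + h) C suc (suc h)                      ≡⟨ cong (_C suc (suc h)) (sym (+-suc m h)) ⟩
    (m + suc h) C suc (suc h)                      ∎
    where open ≤-Reasoning

module PowerSeries where

  open import Data.Nat as ℕ using (ℕ; zero; suc; z≤n; s≤s)
  import Data.Nat.Properties as ℕ
  open import Data.Nat.GeneralisedArithmetic using (fold; fold-+)
  open import Data.Nat.Combinatorics using (_C_; k>n⇒nCk≡0; nCk+nC[k+1]≡[n+1]C[k+1])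
  open import Data.Integer using (ℤ; +_; -_; _+_; _*_; _^_; _≤_; _<_; 0ℤ; 1ℤ; -1ℤ; +≤+; +<+)
  open import Data.Integer.Properties
  open import Data.Integer.Tactic.RingSolver using (solve-∀)
  open import Data.Product using (_,_)
  open import Data.Sum using (_⊎_; inj₁; inj₂)
  open import Relation.Binary.Definitions using (tri<; tri≈; tri>)
  open import Relation.Binary.PropositionalEquality

  Series : Set
  Series = ℕ → ℤ

  𝟙 : Series
  𝟙 zero = 1ℤ
  𝟙 (suc _) = 0ℤ

  -- geom c F = F / (1 − c x)
  geom : ℤ → Series → Series
  geom c F zero = F zero
  geom c F (suc h) = F (suc h) + c * geom c F h

  -- geom² F = F / (1 − x²)
  geom² : Series → Series
  geom² F zero = F zero
  geom² F (suc zero) = F (suc zero)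
  geom² F (suc (suc h)) = F (suc (suc h)) + geom² F h

  PointwiseCong : (Series → Series) → Set
  PointwiseCong f = ∀ {F G} → F ≗ G → f F ≗ f G

  geom-cong : ∀ c → PointwiseCong (geom c)
  geom-cong c F≗G zero = F≗G zero
  geom-cong c F≗G (suc h) = cong₂ (λ a b → a + c * b) (F≗G (suc h)) (geom-cong c F≗G h)

  geom²-cong : PointwiseCong geom²
  geom²-cong F≗G zero = F≗G zero
  geom²-cong F≗G (suc zero) = F≗G 1
  geom²-cong F≗G (suc (suc h)) = cong₂ _+_ (F≗G (suc (suc h))) (geom²-cong F≗G h)

  fold-cong : ∀ {f} → PointwiseCong f → ∀ k → PointwiseCong (λ F → fold F f k)
  fold-cong f-cong zero F≗G = F≗G
  fold-cong f-cong (suc k) F≗G = f-cong (fold-cong f-cong k F≗G)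

  geom⁺ geom⁻ : Series → Series
  geom⁺ = geom 1ℤ
  geom⁻ = geom -1ℤ

  geom-geom-neg : ∀ c → c * c ≡ 1ℤ → ∀ F → geom c (geom (- c) F) ≗ geom² F
  geom-geom-neg c c²≡1 F zero = refl
  geom-geom-neg c c²≡1 F (suc zero) = lemma (F 1) c (F 0)
    where
      lemma : ∀ a c b → (a + (- c) * b) + c * b ≡ a
      lemma = solve-∀
  geom-geom-neg c c²≡1 F (suc (suc h)) = begin
    (F (suc (suc h)) + (- c) * G (suc h)) + c * (G (suc h) + c * GG h)
      ≡⟨ lemma (F (suc (suc h))) c (G (suc h)) (GG h) ⟩
    F (suc (suc h)) + (c * c) * GG h
      ≡⟨ cong₂ (λ x y → F (suc (suc h)) + x * y) c²≡1 (geom-geom-neg c c²≡1 F h) ⟩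
    F (suc (suc h)) + 1ℤ * geom² F h
      ≡⟨ cong (λ x → F (suc (suc h)) + x) (*-identityˡ (geom² F h)) ⟩
    geom² F (suc (suc h)) ∎
    where
      open ≡-Reasoning
      G = geom (- c) F
      GG = geom c G
      lemma : ∀ a c g gg → (a + (- c) * g) + c * (g + c * gg) ≡ a + (c * c) * gg
      lemma = solve-∀

  geom⁺∘geom⁻ : ∀ F → geom⁺ (geom⁻ F) ≗ geom² F
  geom⁺∘geom⁻ = geom-geom-neg 1ℤ refl

  geom⁻∘geom⁺ : ∀ F → geom⁻ (geom⁺ F) ≗ geom² F
  geom⁻∘geom⁺ = geom-geom-neg -1ℤ refl

  geom⁻-geom⁺-comm : ∀ F → geom⁻ (geom⁺ F) ≗ geom⁺ (geom⁻ F)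
  geom⁻-geom⁺-comm F h = trans (geom⁻∘geom⁺ F h) (sym (geom⁺∘geom⁻ F h))

  geom⁻-geom⁺^-comm : ∀ e F → geom⁻ (fold F geom⁺ e) ≗ fold (geom⁻ F) geom⁺ e
  geom⁻-geom⁺^-comm zero F h = refl
  geom⁻-geom⁺^-comm (suc e) F h =
    trans (geom⁻-geom⁺-comm (fold F geom⁺ e) h) (geom-cong 1ℤ (geom⁻-geom⁺^-comm e F) h)

  geom⁻^-geom⁺^-comm : ∀ e o F → fold (fold F geom⁺ o) geom⁻ e ≗ fold (fold F geom⁻ e) geom⁺ o
  geom⁻^-geom⁺^-comm zero o F h = refl
  geom⁻^-geom⁺^-comm (suc e) o F h =
    trans (geom-cong -1ℤ (geom⁻^-geom⁺^-comm e o F) h) (geom⁻-geom⁺^-comm o (fold F geom⁻ e) h)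

  geom⁺^∘geom⁻^≗geom²^ : ∀ o F → fold (fold F geom⁻ o) geom⁺ o ≗ fold F geom² o
  geom⁺^∘geom⁻^≗geom²^ zero F h = refl
  geom⁺^∘geom⁻^≗geom²^ (suc o) F h =
    trans (geom-cong 1ℤ (λ x → sym (geom⁻-geom⁺^-comm o (fold F geom⁻ o) x)) h)
      (trans (geom⁺∘geom⁻ (fold (fold F geom⁻ o) geom⁺ o) h) (geom²-cong (geom⁺^∘geom⁻^≗geom²^ o F) h))

  invPow : ℕ → ℕ → Series
  invPow e o = fold (fold 𝟙 geom⁻ o) geom⁺ e

  sign : ℕ → ℤ
  sign t = -1ℤ ^ t

  sign-cases : ∀ t → sign t ≡ 1ℤ ⊎ sign t ≡ -1ℤ
  sign-cases zero = inj₁ refl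
  sign-cases (suc t) with sign-cases t
  ... | inj₁ s≡1 = inj₂ (cong (-1ℤ *_) s≡1)
  ... | inj₂ s≡-1 = inj₁ (cong (-1ℤ *_) s≡-1)

  sign-double : ∀ y → sign (2 ℕ.* y) ≡ 1ℤ
  sign-double y = begin
    sign (y ℕ.+ (y ℕ.+ 0)) ≡⟨ ^-distribˡ-+-* -1ℤ y (y ℕ.+ 0) ⟩
    sign y * sign (y ℕ.+ 0) ≡⟨ cong (λ z → sign y * sign z) (ℕ.+-identityʳ y) ⟩
    sign y * sign y        ≡⟨ square (sign-cases y) ⟩
    1ℤ                     ∎
    where
      open ≡-Reasoning
      square : ∀ {s} → s ≡ 1ℤ ⊎ s ≡ -1ℤ → s * s ≡ 1ℤ
      square (inj₁ refl) = refl
      square (inj₂ refl) = refl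

  reflect : Series → Series
  reflect F h = sign h * F h

  reflect-geom : ∀ c F → reflect (geom c F) ≗ geom (- c) (reflect F)
  reflect-geom c F zero = refl
  reflect-geom c F (suc h) = begin
    sign (suc h) * (F (suc h) + c * geom c F h)
      ≡⟨ lemma (sign h) (F (suc h)) c (geom c F h) ⟩
    sign (suc h) * F (suc h) + (- c) * (sign h * geom c F h)
      ≡⟨ cong (λ x → sign (suc h) * F (suc h) + (- c) * x) (reflect-geom c F h) ⟩
    geom (- c) (reflect F) (suc h) ∎
    where
      open ≡-Reasoning
      lemma : ∀ s a c g → (- 1ℤ * s) * (a + c * g) ≡ (- 1ℤ * s) * a + (- c) * (s * g)
      lemma = solve-∀

  reflect-geom^ : ∀ c e F → reflect (fold F (geom c) e) ≗ fold (reflect F) (geom (- c)) e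
  reflect-geom^ c zero F h = refl
  reflect-geom^ c (suc e) F h =
    trans (reflect-geom c (fold F (geom c) e) h) (geom-cong (- c) (reflect-geom^ c e F) h)

  reflect-𝟙 : reflect 𝟙 ≗ 𝟙
  reflect-𝟙 zero = refl
  reflect-𝟙 (suc h) = *-zeroʳ (sign (suc h))

  reflect-invPow : ∀ e o → reflect (invPow e o) ≗ invPow o e
  reflect-invPow e o h = begin
    reflect (fold (fold 𝟙 geom⁻ o) geom⁺ e) h
      ≡⟨ reflect-geom^ 1ℤ e (fold 𝟙 geom⁻ o) h ⟩
    fold (reflect (fold 𝟙 geom⁻ o)) geom⁻ e h
      ≡⟨ fold-cong (geom-cong -1ℤ) e reflected-inner h ⟩
    fold (fold 𝟙 geom⁺ o) geom⁻ e h
      ≡⟨ geom⁻^-geom⁺^-comm e o 𝟙 h ⟩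
    invPow o e h ∎
    where
      open ≡-Reasoning
      reflected-inner : reflect (fold 𝟙 geom⁻ o) ≗ fold 𝟙 geom⁺ o
      reflected-inner x = trans (reflect-geom^ -1ℤ o 𝟙 x) (fold-cong (geom-cong 1ℤ) o reflect-𝟙 x)

  NonNegative : Series → Set
  NonNegative F = ∀ h → 0ℤ ≤ F h

  geom²-nonNegative : ∀ {F} → NonNegative F → NonNegative (geom² F)
  geom²-nonNegative F≥0 zero = F≥0 zero
  geom²-nonNegative F≥0 (suc zero) = F≥0 1
  geom²-nonNegative F≥0 (suc (suc h)) = +-mono-≤ (F≥0 (suc (suc h))) (geom²-nonNegative F≥0 h)

  geom²^-nonNegative : ∀ o → NonNegative (fold 𝟙 geom² o)
  geom²^-nonNegative zero zero = +≤+ z≤n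
  geom²^-nonNegative zero (suc h) = +≤+ z≤n
  geom²^-nonNegative (suc o) = geom²-nonNegative (geom²^-nonNegative o)

  geom⁺-positive : ∀ {F} → NonNegative F → 0ℤ < F 0 → ∀ h → 0ℤ < geom⁺ F h
  geom⁺-positive F≥0 F0>0 zero = F0>0
  geom⁺-positive {F} F≥0 F0>0 (suc h) =
    +-mono-≤-< (F≥0 (suc h)) (subst (0ℤ <_) (sym (*-identityˡ (geom⁺ F h))) (geom⁺-positive F≥0 F0>0 h))

  geom⁺^-positive : ∀ d {F} → NonNegative F → 0ℤ < F 0 → ∀ h → 0ℤ < fold F geom⁺ (suc d) h
  geom⁺^-positive zero F≥0 F0>0 = geom⁺-positive F≥0 F0>0
  geom⁺^-positive (suc d) F≥0 F0>0 =
    geom⁺-positive (λ h → <⇒≤ (geom⁺^-positive d F≥0 F0>0 h)) (geom⁺^-positive d F≥0 F0>0 0)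

  geom²^-at-0 : ∀ o → fold 𝟙 geom² o 0 ≡ 1ℤ
  geom²^-at-0 zero = refl
  geom²^-at-0 (suc o) = geom²^-at-0 o

  -- (1 − x)^(−e) (1 + x)^(−o) = (1 − x)^(−(e − o)) (1 − x²)^(−o) has positive coefficients when o < e
  invPow-positive : ∀ {e o} → o ℕ.< e → ∀ h → 0ℤ < invPow e o h
  invPow-positive {e} {o} o<e h with ℕ.m≤n⇒∃[o]m+o≡n o<e
  ... | d , refl = begin-strict
    0ℤ
      <⟨ geom⁺^-positive d (geom²^-nonNegative o) (subst (0ℤ <_) (sym (geom²^-at-0 o)) (+<+ (s≤s z≤n))) h ⟩
    fold (fold 𝟙 geom² o) geom⁺ (suc d) h
      ≡⟨ fold-cong (geom-cong 1ℤ) (suc d) (λ x → sym (geom⁺^∘geom⁻^≗geom²^ o 𝟙 x)) h ⟩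
    fold (fold (fold 𝟙 geom⁻ o) geom⁺ o) geom⁺ (suc d) h
      ≡⟨ cong (λ z → z h) (sym (fold-+ (fold 𝟙 geom⁻ o) geom⁺ (suc d) {o})) ⟩
    fold (fold 𝟙 geom⁻ o) geom⁺ (suc d ℕ.+ o) h
      ≡⟨ cong (λ n → invPow (suc n) o h) (ℕ.+-comm d o) ⟩
    invPow (suc o ℕ.+ d) o h ∎
    where open ≤-Reasoning

  invPow-nonzero : ∀ {e o} → e ≢ o → ∀ h → invPow e o h ≢ 0ℤ
  invPow-nonzero {e} {o} e≢o h eq with ℕ.<-cmp o e
  ... | tri< o<e _ _ = <-irrefl (sym eq) (invPow-positive o<e h)
  ... | tri≈ _ o≡e _ = e≢o (sym o≡e)
  ... | tri> _ _ e<o = <-irrefl (sym reflected≡0) (invPow-positive e<o h)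
    where
      reflected≡0 : invPow o e h ≡ 0ℤ
      reflected≡0 = begin
        invPow o e h           ≡⟨ sym (reflect-invPow e o h) ⟩
        sign h * invPow e o h  ≡⟨ cong (sign h *_) eq ⟩
        sign h * 0ℤ            ≡⟨ *-zeroʳ (sign h) ⟩
        0ℤ                     ∎
        where open ≡-Reasoning

  geom^-at-0 : ∀ c M F → fold F (geom c) M 0 ≡ F 0
  geom^-at-0 c zero F = refl
  geom^-at-0 c (suc M) F = geom^-at-0 c M F

  geom⁺^-𝟙-binomial : ∀ M h → fold 𝟙 geom⁺ M h ≡ + ((M ℕ.+ h ℕ.∸ 1) C h)
  geom⁺^-𝟙-binomial zero zero = refl
  geom⁺^-𝟙-binomial zero (suc h) = cong +_ (sym (k>n⇒nCk≡0 (ℕ.n<1+n h)))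
  geom⁺^-𝟙-binomial (suc M) zero = geom^-at-0 1ℤ M 𝟙
  geom⁺^-𝟙-binomial (suc M) (suc h) = begin
    fold 𝟙 geom⁺ M (suc h) + 1ℤ * fold 𝟙 geom⁺ (suc M) h
      ≡⟨ cong₂ (λ a b → a + 1ℤ * b) (geom⁺^-𝟙-binomial M (suc h)) (geom⁺^-𝟙-binomial (suc M) h) ⟩
    + ((M ℕ.+ suc h ℕ.∸ 1) C suc h) + 1ℤ * + ((suc M ℕ.+ h ℕ.∸ 1) C h)
      ≡⟨ cong₂ (λ a b → + ((a ℕ.∸ 1) C suc h) + b) (ℕ.+-suc M h) (*-identityˡ (+ ((M ℕ.+ h) C h))) ⟩
    + (((M ℕ.+ h) C suc h) ℕ.+ ((M ℕ.+ h) C h))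
      ≡⟨ cong +_ (trans (ℕ.+-comm ((M ℕ.+ h) C suc h) _) (nCk+nC[k+1]≡[n+1]C[k+1] (M ℕ.+ h) h)) ⟩
    + ((suc (M ℕ.+ h)) C suc h)
      ≡⟨ cong (λ a → + (a C suc h)) (sym (ℕ.+-suc M h)) ⟩
    + ((suc M ℕ.+ suc h ℕ.∸ 1) C suc h) ∎
    where open ≡-Reasoning

module BinomialParity where

  open PowerSeries
  open import Data.Nat as ℕ using (ℕ; zero; suc; z≤n; s≤s)
  import Data.Nat.Properties as ℕ
  import Data.Nat.Divisibility as ℕ
  open import Data.Nat.GeneralisedArithmetic using (fold)
  open import Data.Nat.Combinatorics using (_C_)
  open import Data.Integer using (ℤ; +_; _+_; _-_; _*_; 0ℤ; 1ℤ; -1ℤ)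
  open import Data.Integer.Properties using (+-inverseʳ; +-identityˡ; *-identityˡ; *-zeroʳ)
  open import Data.Integer.Tactic.RingSolver using (solve-∀)
  open import Data.Integer.Divisibility.Signed
    using (_∣_; divides; ∣⇒∣ᵤ; ∣m∣n⇒∣m+n; ∣n⇒∣m*n; ∣m+n∣n⇒∣m)
  open import Data.Product using (∃; _,_)
  open import Data.Sum using (_⊎_; inj₁; inj₂)
  open import Function using (_∘_)
  open import Relation.Binary.PropositionalEquality

  Even : ℤ → Set
  Even z = + 2 ∣ z

  even-0 : Even 0ℤ
  even-0 = divides 0ℤ refl

  record _≡₂_ (F G : Series) : Set where
    constructor ≡₂-intro
    field ≡₂-at : ∀ h → Even (F h - G h)
  open _≡₂_

  ≗⇒≡₂ : ∀ {F G} → F ≗ G → F ≡₂ G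
  ≗⇒≡₂ {F} {G} F≗G = ≡₂-intro λ h →
    subst Even (sym (trans (cong (_- G h) (F≗G h)) (+-inverseʳ (G h)))) even-0

  ≡₂-trans : ∀ {F G H} → F ≡₂ G → G ≡₂ H → F ≡₂ H
  ≡₂-trans {F} {G} {H} F≡G G≡H = ≡₂-intro λ h →
    subst Even (lemma (F h) (G h) (H h)) (∣m∣n⇒∣m+n (≡₂-at F≡G h) (≡₂-at G≡H h))
    where
      lemma : ∀ a b c → (a - b) + (b - c) ≡ a - c
      lemma = solve-∀

  geom-resp-≡₂ : ∀ c {F G} → F ≡₂ G → geom c F ≡₂ geom c G
  geom-resp-≡₂ c {F} {G} F≡G = ≡₂-intro at
    where
      lemma : ∀ a b c x y → (a - b) + c * (x - y) ≡ (a + c * x) - (b + c * y)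
      lemma = solve-∀
      at : ∀ h → Even (geom c F h - geom c G h)
      at zero = ≡₂-at F≡G zero
      at (suc h) = subst Even (lemma (F (suc h)) (G (suc h)) c (geom c F h) (geom c G h))
        (∣m∣n⇒∣m+n (≡₂-at F≡G (suc h)) (∣n⇒∣m*n c (at h)))

  geom²-resp-≡₂ : ∀ {F G} → F ≡₂ G → geom² F ≡₂ geom² G
  geom²-resp-≡₂ {F} {G} F≡G = ≡₂-intro at
    where
      lemma : ∀ a b x y → (a - b) + (x - y) ≡ (a + x) - (b + y)
      lemma = solve-∀
      at : ∀ h → Even (geom² F h - geom² G h)
      at zero = ≡₂-at F≡G zero
      at (suc zero) = ≡₂-at F≡G 1
      at (suc (suc h)) = subst Even (lemma (F (suc (suc h))) (G (suc (suc h))) (geom² F h) (geom² G h))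
        (∣m∣n⇒∣m+n (≡₂-at F≡G (suc (suc h))) (at h))

  geom⁺≡₂geom⁻ : ∀ F → geom⁺ F ≡₂ geom⁻ F
  geom⁺≡₂geom⁻ F = ≡₂-intro at
    where
      lemma : ∀ a p q → (p - q) + q * + 2 ≡ (a + 1ℤ * p) - (a + -1ℤ * q)
      lemma = solve-∀
      at : ∀ h → Even (geom⁺ F h - geom⁻ F h)
      at zero = subst Even (sym (+-inverseʳ (F 0))) even-0
      at (suc h) = subst Even (lemma (F (suc h)) (geom⁺ F h) (geom⁻ F h))
        (∣m∣n⇒∣m+n (at h) (divides (geom⁻ F h) refl))

  geom⁺²≡₂geom² : ∀ F → geom⁺ (geom⁺ F) ≡₂ geom² F
  geom⁺²≡₂geom² F = ≡₂-trans (geom-resp-≡₂ 1ℤ (geom⁺≡₂geom⁻ F)) (≗⇒≡₂ (geom⁺∘geom⁻ F))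

  geom⁺^-double : ∀ y F → fold F geom⁺ (y ℕ.+ y) ≡₂ fold F geom² y
  geom⁺^-double zero F = ≗⇒≡₂ (λ _ → refl)
  geom⁺^-double (suc y) F rewrite ℕ.+-suc y y =
    ≡₂-trans (geom⁺²≡₂geom² (fold F geom⁺ (y ℕ.+ y))) (geom²-resp-≡₂ (geom⁺^-double y F))

  -- F(x) ↦ F(x²)
  dilate : Series → Series
  dilate F zero = F zero
  dilate F (suc zero) = 0ℤ
  dilate F (suc (suc h)) = dilate (F ∘ suc) h

  dilate-linear : ∀ c F G h → dilate (λ x → F x + c * G x) h ≡ dilate F h + c * dilate G h
  dilate-linear c F G zero = refl
  dilate-linear c F G (suc zero) = sym (trans (+-identityˡ (c * 0ℤ)) (*-zeroʳ c))
  dilate-linear c F G (suc (suc h)) = dilate-linear c (F ∘ suc) (G ∘ suc) h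

  dilate-𝟙 : dilate 𝟙 ≗ 𝟙
  dilate-𝟙 zero = refl
  dilate-𝟙 (suc zero) = refl
  dilate-𝟙 (suc (suc h)) = zero-everywhere h
    where
      zero-everywhere : ∀ h → dilate (λ _ → 0ℤ) h ≡ 0ℤ
      zero-everywhere zero = refl
      zero-everywhere (suc zero) = refl
      zero-everywhere (suc (suc h)) = zero-everywhere h

  geom²∘dilate : ∀ F → geom² (dilate F) ≗ dilate (geom⁺ F)
  geom²∘dilate F zero = refl
  geom²∘dilate F (suc zero) = refl
  geom²∘dilate F (suc (suc h)) = begin
    dilate (F ∘ suc) h + geom² (dilate F) h
      ≡⟨ cong (λ x → dilate (F ∘ suc) h + x) (trans (geom²∘dilate F h) (sym (*-identityˡ _))) ⟩
    dilate (F ∘ suc) h + 1ℤ * dilate (geom⁺ F) h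
      ≡⟨ sym (dilate-linear 1ℤ (F ∘ suc) (geom⁺ F) h) ⟩
    dilate (geom⁺ F ∘ suc) h ∎
    where open ≡-Reasoning

  geom²^-𝟙 : ∀ y → fold 𝟙 geom² y ≗ dilate (fold 𝟙 geom⁺ y)
  geom²^-𝟙 zero h = sym (dilate-𝟙 h)
  geom²^-𝟙 (suc y) h = trans (geom²-cong (geom²^-𝟙 y) h) (geom²∘dilate (fold 𝟙 geom⁺ y) h)

  dilate-even : ∀ F j → dilate F (j ℕ.+ j) ≡ F j
  dilate-even F zero = refl
  dilate-even F (suc j) rewrite ℕ.+-suc j j = dilate-even (F ∘ suc) j

  dilate-odd : ∀ F j → dilate F (suc (j ℕ.+ j)) ≡ 0ℤ
  dilate-odd F zero = refl
  dilate-odd F (suc j) rewrite ℕ.+-suc j j = dilate-odd (F ∘ suc) j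

  even-or-odd : ∀ h → ∃ λ j → h ≡ j ℕ.+ j ⊎ h ≡ suc (j ℕ.+ j)
  even-or-odd zero = zero , inj₁ refl
  even-or-odd (suc h) with even-or-odd h
  ... | j , inj₁ h≡2j = j , inj₂ (cong suc h≡2j)
  ... | j , inj₂ h≡2j+1 = suc j , inj₁ (trans (cong suc h≡2j+1) (sym (ℕ.+-suc (suc j) j)))

  EvenBelow : ℕ → Series → Set
  EvenBelow r F = ∀ h → 1 ℕ.≤ h → h ℕ.< 2 ℕ.^ r → Even (F h)

  EvenBelow-resp-≡₂ : ∀ {r F G} → F ≡₂ G → EvenBelow r G → EvenBelow r F
  EvenBelow-resp-≡₂ {F = F} {G} F≡G G-even h 1≤h h<2^r =
    subst Even (lemma (F h) (G h)) (∣m∣n⇒∣m+n (≡₂-at F≡G h) (G-even h 1≤h h<2^r))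
    where
      lemma : ∀ a b → (a - b) + b ≡ a
      lemma = solve-∀

  dilate-EvenBelow : ∀ r F → EvenBelow r F → EvenBelow (suc r) (dilate F)
  dilate-EvenBelow r F F-even h 1≤h h<2^r+1 with even-or-odd h
  ... | j , inj₂ refl = subst Even (sym (dilate-odd F j)) even-0
  ... | zero , inj₁ refl with () ← 1≤h
  ... | suc j , inj₁ refl = subst Even (sym (dilate-even F (suc j))) (F-even (suc j) (s≤s z≤n) j<2^r)
    where
      j<2^r : suc j ℕ.< 2 ℕ.^ r
      j<2^r = ℕ.≰⇒> λ 2^r≤j → ℕ.<⇒≱ h<2^r+1 (begin
        2 ℕ.^ suc r                    ≡⟨ cong (2 ℕ.^ r ℕ.+_) (ℕ.+-identityʳ (2 ℕ.^ r)) ⟩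
        2 ℕ.^ r ℕ.+ 2 ℕ.^ r            ≤⟨ ℕ.+-mono-≤ 2^r≤j 2^r≤j ⟩
        suc j ℕ.+ suc j                ∎)
        where open ℕ.≤-Reasoning

  -- (1 − x)^(−2^r k) ≡ (1 − x^(2^r))^(−k) mod 2
  geom⁺^-EvenBelow : ∀ r k → EvenBelow r (fold 𝟙 geom⁺ (2 ℕ.^ r ℕ.* k))
  geom⁺^-EvenBelow zero k h 1≤h (s≤s h≤0) with () ← ℕ.<-≤-trans 1≤h h≤0
  geom⁺^-EvenBelow (suc r) k =
    subst (λ n → EvenBelow (suc r) (fold 𝟙 geom⁺ n)) (sym 2^r+1k≡y+y)
      (EvenBelow-resp-≡₂ {suc r} (geom⁺^-double y 𝟙)
        (EvenBelow-resp-≡₂ {suc r} (≗⇒≡₂ (geom²^-𝟙 y)) (dilate-EvenBelow r _ (geom⁺^-EvenBelow r k))))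
    where
      y = 2 ℕ.^ r ℕ.* k
      2^r+1k≡y+y : 2 ℕ.^ suc r ℕ.* k ≡ y ℕ.+ y
      2^r+1k≡y+y = trans (ℕ.*-assoc 2 (2 ℕ.^ r) k) (cong (y ℕ.+_) (ℕ.+-identityʳ y))

  -- [xʰ] (1 − x)^(−M) = [xʰ] (1 − x)^(−(M+1)) − [xʰ⁻¹] (1 − x)^(−(M+1))
  geom⁺^-even : ∀ r k M h → suc M ≡ 2 ℕ.^ r ℕ.* k → 2 ℕ.≤ h → h ℕ.< 2 ℕ.^ r →
                Even (fold 𝟙 geom⁺ M h)
  geom⁺^-even r k M (suc h) M+1≡2^rk (s≤s 1≤h) h+1<2^r =
    ∣m+n∣n⇒∣m (even-at (suc h) (s≤s z≤n) h+1<2^r)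
              (∣n⇒∣m*n 1ℤ (even-at h 1≤h (ℕ.<-trans (ℕ.n<1+n h) h+1<2^r)))
    where
      even-at : EvenBelow r (fold 𝟙 geom⁺ (suc M))
      even-at = subst (λ n → EvenBelow r (fold 𝟙 geom⁺ n)) (sym M+1≡2^rk) (geom⁺^-EvenBelow r k)

  binomial-even : ∀ r k m h → suc m ≡ 2 ℕ.^ r ℕ.* k → 2 ℕ.≤ h → h ℕ.< 2 ℕ.^ r →
                  ∃ λ q → (m ℕ.+ h ℕ.∸ 1) C h ≡ 2 ℕ.* q
  binomial-even r k m h m+1≡2^rk 2≤h h<2^r
    with ∣⇒∣ᵤ (subst Even (geom⁺^-𝟙-binomial m h) (geom⁺^-even r k m h m+1≡2^rk 2≤h h<2^r))
  ... | ℕ.divides q n≡q*2 = q , trans n≡q*2 (ℕ.*-comm q 2)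

module MultisetSums where

  open PowerSeries
  open import Data.Nat using (ℕ; zero; suc; _+_; _*_)
  open import Data.Nat.Properties using (+-assoc; +-suc; suc-injective)
  open import Data.Nat.GeneralisedArithmetic using (fold)
  open import Data.Nat.ListAction using (sum)
  open import Data.Integer as ℤ using (ℤ; +_; 0ℤ; 1ℤ; -1ℤ)
  import Data.Integer.Properties as ℤ
  open import Data.Fin using (Fin; zero; suc)
  open import Data.Fin.Subset using (Subset; inside; outside; ∣_∣) renaming (_∈_ to _∈ₛ_)
  open import Data.Vec using ([]; _∷_; here; there)
  open import Data.Vec.Functional using (foldr) renaming (_∷_ to _∷ᶠ_)
  import Data.List as List
  open import Data.List using (List; [_]; _++_; map; allFin; tabulate; length)
  open import Data.List.Properties using (map-tabulate; length-++; length-map)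
  open import Data.List.Membership.Propositional using (_∈_)
  open import Data.List.Membership.Propositional.Properties using (∈-++⁺ˡ; ∈-++⁺ʳ; ∈-++⁻; ∈-map⁺; ∈-map⁻)
  open import Data.List.Relation.Unary.Any using (here)
  open import Data.Product using (Σ; ∃₂; _×_; _,_)
  open import Data.Sum using (_⊎_; inj₁; inj₂)
  open import Function using (_∘_; id)
  open import Relation.Binary.PropositionalEquality
    using (_≡_; _≗_; refl; sym; trans; cong; cong₂; subst; module ≡-Reasoning)

  Σ[_] : ∀ {n} → (Fin n → ℕ) → ℕ
  Σ[_] = foldr _+_ 0

  Σ≡sum-allFin : ∀ n (f : Fin n → ℕ) → Σ[ f ] ≡ sum (map f (allFin n))
  Σ≡sum-allFin zero f = refl
  Σ≡sum-allFin (suc n) f = cong (_+_ (f zero)) (begin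
    Σ[ f ∘ suc ]                   ≡⟨ Σ≡sum-allFin n (f ∘ suc) ⟩
    sum (map (f ∘ suc) (allFin n)) ≡⟨ cong sum (map-tabulate id (f ∘ suc)) ⟩
    sum (tabulate (f ∘ suc))       ≡⟨ cong sum (sym (map-tabulate suc f)) ⟩
    sum (map f (tabulate suc))     ∎)
    where open ≡-Reasoning

  SupportedOn : ∀ {n} → Subset n → (Fin n → ℕ) → Set
  SupportedOn A c = ∀ i → c i ≡ 0 ⊎ i ∈ₛ A

  SupportedOn-tail : ∀ {n b} {A : Subset n} {c : Fin (suc n) → ℕ} →
                     SupportedOn (b ∷ A) c → SupportedOn A (c ∘ suc)
  SupportedOn-tail supp i with supp (suc i)
  ... | inj₁ cᵢ≡0 = inj₁ cᵢ≡0
  ... | inj₂ (there i∈A) = inj₂ i∈A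

  SupportedOn-cons : ∀ {n b} {A : Subset n} {c : Fin n → ℕ} → SupportedOn A c → SupportedOn (b ∷ A) (0 ∷ᶠ c)
  SupportedOn-cons supp zero = inj₁ refl
  SupportedOn-cons supp (suc i) with supp i
  ... | inj₁ cᵢ≡0 = inj₁ cᵢ≡0
  ... | inj₂ i∈A = inj₂ (there i∈A)

  -- all sums Σ cᵢ wᵢ with c supported on A and Σ cᵢ = h, listed with multiplicity
  sums : ∀ n → Subset n → (Fin n → ℕ) → ℕ → List ℕ
  sums zero [] w zero = [ 0 ]
  sums zero [] w (suc h) = List.[]
  sums (suc n) (outside ∷ A) w h = sums n A (w ∘ suc) h
  sums (suc n) (inside ∷ A) w zero = sums n A (w ∘ suc) zero
  sums (suc n) (inside ∷ A) w (suc h) = map (_+_ (w zero)) (sums (suc n) (inside ∷ A) w h) ++ sums n A (w ∘ suc) (suc h)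

  IsSum : ∀ n → Subset n → (Fin n → ℕ) → ℕ → ℕ → Set
  IsSum n A w h t = Σ (Fin n → ℕ) λ c → SupportedOn A c × Σ[ c ] ≡ h × Σ[ (λ i → c i * w i) ] ≡ t

  IsSum-tail : ∀ {n b} {A : Subset n} w {h t} → IsSum n A (w ∘ suc) h t → IsSum (suc n) (b ∷ A) w h t
  IsSum-tail w (c , supp , Σc≡h , Σcw≡t) = 0 ∷ᶠ c , SupportedOn-cons supp , Σc≡h , Σcw≡t

  sums-sound : ∀ n A w h t → t ∈ sums n A w h → IsSum n A w h t
  sums-sound zero [] w zero t (here refl) = (λ ()) , (λ ()) , refl , refl
  sums-sound (suc n) (outside ∷ A) w h t t∈ = IsSum-tail w (sums-sound n A (w ∘ suc) h t t∈)
  sums-sound (suc n) (inside ∷ A) w zero t t∈ = IsSum-tail w (sums-sound n A (w ∘ suc) zero t t∈)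
  sums-sound (suc n) (inside ∷ A) w (suc h) t t∈ with ∈-++⁻ (map (_+_ (w zero)) (sums (suc n) (inside ∷ A) w h)) t∈
  ... | inj₂ t∈tail = IsSum-tail w (sums-sound n A (w ∘ suc) (suc h) t t∈tail)
  ... | inj₁ t∈shifted with ∈-map⁻ (_+_ (w zero)) t∈shifted
  ...   | t′ , t′∈ , refl with sums-sound (suc n) (inside ∷ A) w h t′ t′∈
  ...     | c , supp , Σc≡h , Σcw≡t′ =
    suc (c zero) ∷ᶠ (c ∘ suc) , supp′ , cong suc Σc≡h ,
    trans (+-assoc (w zero) _ _) (cong (_+_ (w zero)) Σcw≡t′)
    where
      supp′ : SupportedOn (inside ∷ A) (suc (c zero) ∷ᶠ (c ∘ suc))
      supp′ zero = inj₂ here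
      supp′ (suc i) = supp (suc i)

  sums-tail : ∀ n A w h → ∀ {t} → t ∈ sums n A (w ∘ suc) h → t ∈ sums (suc n) (inside ∷ A) w h
  sums-tail n A w zero t∈ = t∈
  sums-tail n A w (suc h) t∈ = ∈-++⁺ʳ (map (_+_ (w zero)) (sums (suc n) (inside ∷ A) w h)) t∈

  sums-complete : ∀ n A w h (c : Fin n → ℕ) → SupportedOn A c → Σ[ c ] ≡ h →
                  Σ[ (λ i → c i * w i) ] ∈ sums n A w h
  sums-complete zero [] w zero c supp Σc≡h = here refl
  sums-complete (suc n) (outside ∷ A) w h c supp Σc≡h with supp zero
  ... | inj₁ c₀≡0 rewrite c₀≡0 = sums-complete n A (w ∘ suc) h (c ∘ suc) (SupportedOn-tail supp) Σc≡h
  sums-complete (suc n) (inside ∷ A) w h c supp Σc≡h with c zero in c₀≡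
  ... | zero = sums-tail n A w h (sums-complete n A (w ∘ suc) h (c ∘ suc) (SupportedOn-tail supp) Σc≡h)
  sums-complete (suc n) (inside ∷ A) w (suc h) c supp Σc≡h | suc j =
    subst (_∈ sums (suc n) (inside ∷ A) w (suc h)) (sym (+-assoc (w zero) (j * w zero) _))
      (∈-++⁺ˡ (∈-map⁺ (_+_ (w zero)) (sums-complete (suc n) (inside ∷ A) w h c′ supp′ (suc-injective Σc≡h))))
    where
      c′ : Fin (suc n) → ℕ
      c′ = j ∷ᶠ (c ∘ suc)
      supp′ : SupportedOn (inside ∷ A) c′
      supp′ zero = inj₂ here
      supp′ (suc i) = supp (suc i)

  length-sums : ∀ n A w h → + length (sums n A w h) ≡ fold 𝟙 geom⁺ ∣ A ∣ h
  length-sums zero [] w zero = refl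
  length-sums zero [] w (suc h) = refl
  length-sums (suc n) (outside ∷ A) w h = length-sums n A (w ∘ suc) h
  length-sums (suc n) (inside ∷ A) w zero = length-sums n A (w ∘ suc) zero
  length-sums (suc n) (inside ∷ A) w (suc h) = begin
    + length (shifted ++ tail)
      ≡⟨ cong +_ (trans (length-++ shifted) (cong (_+ length tail) (length-map (_+_ (w zero)) shorter))) ⟩
    + length shorter ℤ.+ + length tail
      ≡⟨ ℤ.+-comm (+ length shorter) (+ length tail) ⟩
    + length tail ℤ.+ + length shorter
      ≡⟨ cong₂ ℤ._+_ (length-sums n A (w ∘ suc) (suc h))
                     (trans (length-sums (suc n) (inside ∷ A) w h) (sym (ℤ.*-identityˡ _))) ⟩
    fold 𝟙 geom⁺ (suc ∣ A ∣) (suc h) ∎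
    where
      open ≡-Reasoning
      shorter = sums (suc n) (inside ∷ A) w h
      shifted = map (_+_ (w zero)) shorter
      tail = sums n A (w ∘ suc) (suc h)

  signedSum : List ℕ → ℤ
  signedSum List.[] = 0ℤ
  signedSum (t List.∷ ts) = sign t ℤ.+ signedSum ts

  signedSum-++ : ∀ xs ys → signedSum (xs ++ ys) ≡ signedSum xs ℤ.+ signedSum ys
  signedSum-++ List.[] ys = sym (ℤ.+-identityˡ (signedSum ys))
  signedSum-++ (x List.∷ xs) ys =
    trans (cong (ℤ._+_ (sign x)) (signedSum-++ xs ys)) (sym (ℤ.+-assoc (sign x) (signedSum xs) (signedSum ys)))

  signedSum-shift : ∀ c xs → signedSum (map (_+_ c) xs) ≡ sign c ℤ.* signedSum xs
  signedSum-shift c List.[] = sym (ℤ.*-zeroʳ (sign c))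
  signedSum-shift c (x List.∷ xs) =
    trans (cong₂ ℤ._+_ (ℤ.^-distribˡ-+-* -1ℤ c x) (signedSum-shift c xs))
      (sym (ℤ.*-distribˡ-+ (sign c) (sign x) (signedSum xs)))

  -- the generating function Π_{i ∈ A} 1 / (1 − (−1)^{wᵢ} x)
  signedSeries : ∀ n → Subset n → (Fin n → ℕ) → Series
  signedSeries zero [] w = 𝟙
  signedSeries (suc n) (outside ∷ A) w = signedSeries n A (w ∘ suc)
  signedSeries (suc n) (inside ∷ A) w = geom (sign (w zero)) (signedSeries n A (w ∘ suc))

  signedSum-sums : ∀ n A w h → signedSum (sums n A w h) ≡ signedSeries n A w h
  signedSum-sums zero [] w zero = refl
  signedSum-sums zero [] w (suc h) = refl
  signedSum-sums (suc n) (outside ∷ A) w h = signedSum-sums n A (w ∘ suc) h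
  signedSum-sums (suc n) (inside ∷ A) w zero = signedSum-sums n A (w ∘ suc) zero
  signedSum-sums (suc n) (inside ∷ A) w (suc h) = begin
    signedSum (map (_+_ (w zero)) shorter ++ tail)
      ≡⟨ signedSum-++ (map (_+_ (w zero)) shorter) tail ⟩
    signedSum (map (_+_ (w zero)) shorter) ℤ.+ signedSum tail
      ≡⟨ cong₂ ℤ._+_ (trans (signedSum-shift (w zero) shorter)
                             (cong (sign (w zero) ℤ.*_) (signedSum-sums (suc n) (inside ∷ A) w h)))
                     (signedSum-sums n A (w ∘ suc) (suc h)) ⟩
    sign (w zero) ℤ.* signedSeries (suc n) (inside ∷ A) w h ℤ.+ signedSeries n A (w ∘ suc) (suc h)
      ≡⟨ ℤ.+-comm (sign (w zero) ℤ.* signedSeries (suc n) (inside ∷ A) w h) (signedSeries n A (w ∘ suc) (suc h)) ⟩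
    signedSeries (suc n) (inside ∷ A) w (suc h) ∎
    where
      open ≡-Reasoning
      shorter = sums (suc n) (inside ∷ A) w h
      tail = sums n A (w ∘ suc) (suc h)

  -- e and o count the members of A of even and of odd weight
  signedSeries-invPow : ∀ n A w → ∃₂ λ e o → e + o ≡ ∣ A ∣ × signedSeries n A w ≗ invPow e o
  signedSeries-invPow zero [] w = 0 , 0 , refl , (λ _ → refl)
  signedSeries-invPow (suc n) (outside ∷ A) w = signedSeries-invPow n A (w ∘ suc)
  signedSeries-invPow (suc n) (inside ∷ A) w = extend (signedSeries-invPow n A (w ∘ suc)) (sign-cases (w zero))
    where
      S = signedSeries n A (w ∘ suc)
      extend : (∃₂ λ e o → e + o ≡ ∣ A ∣ × S ≗ invPow e o) →
               sign (w zero) ≡ 1ℤ ⊎ sign (w zero) ≡ -1ℤ →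
               ∃₂ λ e o → e + o ≡ suc ∣ A ∣ × geom (sign (w zero)) S ≗ invPow e o
      extend (e , o , e+o≡∣A∣ , S≗) (inj₁ s≡1) =
        suc e , o , cong suc e+o≡∣A∣ , λ h → trans (cong (λ c → geom c S h) s≡1) (geom-cong 1ℤ S≗ h)
      extend (e , o , e+o≡∣A∣ , S≗) (inj₂ s≡-1) =
        e , suc o , trans (+-suc e o) (cong suc e+o≡∣A∣) ,
        λ h → trans (cong (λ c → geom c S h) s≡-1)
                    (trans (geom-cong -1ℤ S≗ h) (geom⁻-geom⁺^-comm e (fold 𝟙 geom⁻ o) h))

module Counting where

  open PowerSeries using (sign; sign-cases; sign-double)
  open MultisetSums using (signedSum)
  open import Data.Nat using (ℕ; zero; suc; _+_; _*_; _<_; _≤_; NonZero)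
  open import Data.Nat.Properties
  open import Data.Nat.DivMod using (_%_; [m+kn]%n≡m%n; m<n⇒m%n≡m)
  open import Data.Integer as ℤ using (ℤ; +_; 0ℤ; 1ℤ; -1ℤ)
  import Data.Integer.Properties as ℤ
  open import Data.Integer.Tactic.RingSolver using (solve-∀)
  open import Data.Fin using (Fin; toℕ; fromℕ<)
  open import Data.Fin.Properties using (toℕ<n; toℕ-fromℕ<; toℕ-injective; injective⇒≤)
  open import Data.List using (List; []; _∷_; length; filter; lookup)
  open import Data.List.Membership.Propositional using (_∈_)
  open import Data.List.Membership.Propositional.Properties using (∈-filter⁺)
  open import Data.List.Relation.Unary.Any using (index)
  open import Data.List.Relation.Unary.Any.Properties using (lookup-index)
  open import Data.Empty using (⊥-elim)
  open import Data.Product using (∃; _×_; _,_; proj₁; proj₂)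
  open import Data.Sum using ([_,_]′)
  open import Function using (_∘_)
  open import Relation.Nullary using (yes; no; contradiction)
  open import Relation.Binary.PropositionalEquality

  Covers : (N : ℕ) → List ℕ → Set
  Covers N xs = ∀ (x : Fin N) → ∃ λ t → t ∈ xs × t ≡ toℕ x [mod N ]

  mod-residue : ∀ {N} .{{_ : NonZero N}} {t b} → t ≡ b [mod N ] → b < N → t % N ≡ b
  mod-residue {N} {b = b} (k , refl) b<N = trans ([m+kn]%n≡m%n b k N) (m<n⇒m%n≡m b<N)

  mod-unique : ∀ {N} .{{_ : NonZero N}} {t a b} → t ≡ a [mod N ] → t ≡ b [mod N ] → a < N → b < N → a ≡ b
  mod-unique t≡a t≡b a<N b<N = trans (sym (mod-residue t≡a a<N)) (mod-residue t≡b b<N)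

  -- the witnesses for distinct residues sit at distinct positions of ys
  covered-residues-≤length : ∀ {q N} .{{_ : NonZero N}} (r : Fin q → ℕ) →
    (∀ {i j} → r i ≡ r j → i ≡ j) → (∀ j → r j < N) →
    (ys : List ℕ) → (∀ j → ∃ λ t → t ∈ ys × t ≡ r j [mod N ]) → q ≤ length ys
  covered-residues-≤length r r-injective r<N ys covered = injective⇒≤ index-injective
    where
      position : ∀ j → Fin (length ys)
      position j = let _ , t∈ys , _ = covered j in index t∈ys
      at-position : ∀ j → lookup ys (position j) ≡ r j [mod _ ]
      at-position j = let _ , t∈ys , t≡r = covered j in subst (_≡ r j [mod _ ]) (lookup-index t∈ys) t≡r
      index-injective : ∀ {i j} → position i ≡ position j → i ≡ j
      index-injective {i} {j} eq =
        r-injective (mod-unique (subst (λ p → lookup ys p ≡ r i [mod _ ]) eq (at-position i))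
                                (at-position j) (r<N i) (r<N j))

  sign-mod-even : ∀ {q t b} → t ≡ b [mod 2 * q ] → sign t ≡ sign b
  sign-mod-even {q} {b = b} (k , refl) = begin
    sign (b + k * (2 * q))      ≡⟨ cong (λ x → sign (b + x)) (*-comm k (2 * q)) ⟩
    sign (b + 2 * q * k)        ≡⟨ cong (λ x → sign (b + x)) (*-assoc 2 q k) ⟩
    sign (b + 2 * (q * k))      ≡⟨ ℤ.^-distribˡ-+-* -1ℤ b (2 * (q * k)) ⟩
    sign b ℤ.* sign (2 * (q * k)) ≡⟨ cong (sign b ℤ.*_) (sign-double (q * k)) ⟩
    sign b ℤ.* 1ℤ               ≡⟨ ℤ.*-identityʳ (sign b) ⟩
    sign b                      ∎
    where open ≡-Reasoning

  evens odds : List ℕ → List ℕ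
  evens = filter (λ t → sign t ℤ.≟ 1ℤ)
  odds = filter (λ t → sign t ℤ.≟ -1ℤ)

  1ℤ≢-1ℤ : 1ℤ ≢ -1ℤ
  1ℤ≢-1ℤ ()

  evens-odds-split : ∀ xs → length (evens xs) + length (odds xs) ≡ length xs
                          × signedSum xs ≡ + length (evens xs) ℤ.- + length (odds xs)
  evens-odds-split [] = refl , refl
  evens-odds-split (x ∷ xs) with evens-odds-split xs | sign x ℤ.≟ 1ℤ | sign x ℤ.≟ -1ℤ
  ... | _ | yes s≡1 | yes s≡-1 = contradiction (trans (sym s≡1) s≡-1) 1ℤ≢-1ℤ
  ... | length≡ , signedSum≡ | yes s≡1 | no _ =
    cong suc length≡ , trans (cong₂ ℤ._+_ s≡1 signedSum≡) (lemma (+ length (evens xs)) (+ length (odds xs)))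
    where
      lemma : ∀ a b → 1ℤ ℤ.+ (a ℤ.- b) ≡ (1ℤ ℤ.+ a) ℤ.- b
      lemma = solve-∀
  ... | length≡ , signedSum≡ | no _ | yes s≡-1 =
    trans (+-suc _ _) (cong suc length≡) ,
    trans (cong₂ ℤ._+_ s≡-1 signedSum≡) (lemma (+ length (evens xs)) (+ length (odds xs)))
    where
      lemma : ∀ a b → -1ℤ ℤ.+ (a ℤ.- b) ≡ a ℤ.- (1ℤ ℤ.+ b)
      lemma = solve-∀
  ... | _ | no s≢1 | no s≢-1 = ⊥-elim ([ s≢1 , s≢-1 ]′ (sign-cases x))

  balanced : ∀ {q e o} → q ≤ e → q ≤ o → e + o ≡ q + q → e ≡ o
  balanced {q} {e} {o} q≤e q≤o e+o≡q+q = trans e≡q (sym o≡q)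
    where
      e≡q : e ≡ q
      e≡q = ≤-antisym (+-cancelʳ-≤ q e q (subst (e + q ≤_) e+o≡q+q (+-monoʳ-≤ e q≤o))) q≤e
      o≡q : o ≡ q
      o≡q = ≤-antisym (+-cancelˡ-≤ q o q (subst (q + o ≤_) e+o≡q+q (+-monoˡ-≤ o q≤e))) q≤o

  Covers-residue : ∀ {N xs} → Covers N xs → ∀ {b} → b < N → ∃ λ t → t ∈ xs × t ≡ b [mod N ]
  Covers-residue covers b<N =
    let t , t∈xs , t≡ = covers (fromℕ< b<N) in t , t∈xs , subst (λ b → t ≡ b [mod _ ]) (toℕ-fromℕ< b<N) t≡

  -- such a list meets every residue exactly once, so half of its entries are even
  signedSum-covering : ∀ q xs → length xs ≡ 2 * q → Covers (2 * q) xs → signedSum xs ≡ 0ℤ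
  signedSum-covering zero [] _ _ = refl
  signedSum-covering q@(suc _) xs length≡ covers = begin
    signedSum xs                                ≡⟨ proj₂ (evens-odds-split xs) ⟩
    + length (evens xs) ℤ.- + length (odds xs)  ≡⟨ cong (λ e → + e ℤ.- + length (odds xs)) evens≡odds ⟩
    + length (odds xs) ℤ.- + length (odds xs)   ≡⟨ ℤ.+-inverseʳ (+ length (odds xs)) ⟩
    0ℤ                                          ∎
    where
      open ≡-Reasoning
      2j<2q : ∀ (j : Fin q) → 2 * toℕ j < 2 * q
      2j<2q j = *-monoʳ-< 2 (toℕ<n j)
      2j+1<2q : ∀ (j : Fin q) → suc (2 * toℕ j) < 2 * q
      2j+1<2q j = subst (_≤ 2 * q) (*-suc 2 (toℕ j)) (*-monoʳ-≤ 2 (toℕ<n j))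
      double-injective : ∀ {i j : Fin q} → 2 * toℕ i ≡ 2 * toℕ j → i ≡ j
      double-injective eq = toℕ-injective (*-cancelˡ-≡ (toℕ _) (toℕ _) 2 eq)
      evens≥ : q ≤ length (evens xs)
      evens≥ = covered-residues-≤length (λ j → 2 * toℕ j) double-injective 2j<2q (evens xs) λ j →
        let t , t∈xs , t≡2j = Covers-residue covers (2j<2q j)
        in t , ∈-filter⁺ (λ t → sign t ℤ.≟ 1ℤ) t∈xs (trans (sign-mod-even {q} t≡2j) (sign-double (toℕ j))) ,
           t≡2j
      odds≥ : q ≤ length (odds xs)
      odds≥ = covered-residues-≤length (λ j → suc (2 * toℕ j)) (double-injective ∘ suc-injective) 2j+1<2q (odds xs)
        λ j →
        let t , t∈xs , t≡2j+1 = Covers-residue covers (2j+1<2q j)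
        in t , ∈-filter⁺ (λ t → sign t ℤ.≟ -1ℤ) t∈xs
                         (trans (sign-mod-even {q} t≡2j+1) (cong (-1ℤ ℤ.*_) (sign-double (toℕ j)))) ,
           t≡2j+1
      evens≡odds : length (evens xs) ≡ length (odds xs)
      evens≡odds = balanced evens≥ odds≥
        (trans (proj₁ (evens-odds-split xs)) (trans length≡ (cong (_+_ q) (+-identityʳ q))))

module Sumsets where

  open Arithmetic using (≤-binomial)
  open PowerSeries
  open MultisetSums
  open Counting
  open import Data.Nat using (ℕ; zero; suc; _+_; _*_; _∸_; _≤_; _<_; _≟_; _≤?_; z≤n; s≤s; s≤s⁻¹)
  open import Data.Nat.Properties
  open import Data.Nat.DivMod using (_%_; _/_; m≡m%n+[m/n]*n)
  open import Data.Nat.Combinatorics using (_C_)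
  open import Data.Nat.GeneralisedArithmetic using (fold)
  open import Data.Integer as ℤ using (+_; 0ℤ)
  import Data.Integer.Properties as ℤ
  open import Data.Fin using (Fin; toℕ)
  open import Data.Fin.Properties using (toℕ<n)
  open import Data.Fin.Subset using (Subset; inside; outside; ∣_∣) renaming (_∈_ to _∈ₛ_)
  open import Data.Fin.Subset.Properties using (∣p∣≤n; ∣p∣≡n⇒p≡⊤; ∈⊤; ⊆-antisym)
  import Data.Vec as Vec
  open import Data.Vec using ([]; _∷_; tabulate)
  open import Data.Vec.Properties using ([]=⇒lookup; lookup⇒[]=; lookup∘tabulate)
  open import Data.Bool using (true)
  open import Data.List using (length)
  open import Data.List.Membership.Propositional using (find; lose)
  open import Data.List.Relation.Unary.Any using (Any; any?)
  open import Data.Product using (∃; _×_; _,_; proj₁; proj₂)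
  open import Function using (_∘_)
  open import Function.Bundles using (_⇔_; mk⇔; Equivalence)
  open import Relation.Nullary using (Dec; yes; no; does; contradiction)
  open import Relation.Binary.PropositionalEquality

  ≡-mod? : ∀ {n} t (x : Fin n) → Dec (t ≡ toℕ x [mod n ])
  ≡-mod? {suc n} t x with t % suc n ≟ toℕ x
  ... | yes t%n≡x = yes (t / suc n , trans (m≡m%n+[m/n]*n t (suc n)) (cong (_+ t / suc n * suc n) t%n≡x))
  ... | no t%n≢x = no λ t≡x → t%n≢x (mod-residue t≡x (toℕ<n x))

  InSumset⇒sums : ∀ n h A x → InSumset n h A x → Any (_≡ toℕ x [mod n ]) (sums n A toℕ h)
  InSumset⇒sums n h A x (c , supp , Σc≡h , Σcx≡x) =
    lose (sums-complete n A toℕ h c supp (trans (Σ≡sum-allFin n c) Σc≡h))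
         (subst (_≡ toℕ x [mod n ]) (sym (Σ≡sum-allFin n (λ i → c i * toℕ i))) Σcx≡x)

  sums⇒InSumset : ∀ n h A x → Any (_≡ toℕ x [mod n ]) (sums n A toℕ h) → InSumset n h A x
  sums⇒InSumset n h A x any-t with find any-t
  ... | t , t∈sums , t≡x with sums-sound n A toℕ h t t∈sums
  ...   | c , supp , Σc≡h , Σcx≡t =
    c , supp , trans (sym (Σ≡sum-allFin n c)) Σc≡h ,
    subst (_≡ toℕ x [mod n ]) (sym (trans (sym (Σ≡sum-allFin n (λ i → c i * toℕ i))) Σcx≡t)) t≡x

  InSumset? : ∀ n h A x → Dec (InSumset n h A x)
  InSumset? n h A x with any? (λ t → ≡-mod? t x) (sums n A toℕ h)
  ... | yes any-t = yes (sums⇒InSumset n h A x any-t)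
  ... | no ¬any-t = no (¬any-t ∘ InSumset⇒sums n h A x)

  sumset : ∀ n h → Subset n → Subset n
  sumset n h A = tabulate (λ x → does (InSumset? n h A x))

  ∈-sumset⇔ : ∀ n h A x → x ∈ₛ sumset n h A ⇔ InSumset n h A x
  ∈-sumset⇔ n h A x = mk⇔ to from
    where
      entry≡ : Vec.lookup (sumset n h A) x ≡ does (InSumset? n h A x)
      entry≡ = lookup∘tabulate (λ y → does (InSumset? n h A y)) x
      to : x ∈ₛ sumset n h A → InSumset n h A x
      to x∈ with InSumset? n h A x | trans (sym entry≡) ([]=⇒lookup x∈)
      ... | yes x∈hA | _ = x∈hA
      from : InSumset n h A x → x ∈ₛ sumset n h A
      from x∈hA = lookup⇒[]= x (sumset n h A) (trans entry≡ (does-yes (InSumset? n h A x)))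
        where
          does-yes : (d : Dec (InSumset n h A x)) → does d ≡ true
          does-yes (yes _) = refl
          does-yes (no x∉hA) = contradiction x∈hA x∉hA

  sumset-size : ∀ n h A → SumsetSize n h A ∣ sumset n h A ∣
  sumset-size n h A = sumset n h A , ∈-sumset⇔ n h A , refl

  SumsetSize-unique : ∀ n h A s → SumsetSize n h A s → s ≡ ∣ sumset n h A ∣
  SumsetSize-unique n h A s (S , ∈S⇔ , ∣S∣≡s) = trans (sym ∣S∣≡s) (cong ∣_∣ S≡sumset)
    where
      S≡sumset : S ≡ sumset n h A
      S≡sumset = ⊆-antisym (λ {x} x∈S → Equivalence.from (∈-sumset⇔ n h A x) (Equivalence.to (∈S⇔ x) x∈S))
                           (λ {x} x∈hA → Equivalence.from (∈S⇔ x) (Equivalence.to (∈-sumset⇔ n h A x) x∈hA))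

  sumset-not-full : ∀ q h (A : Subset (2 * q)) y s → suc ∣ A ∣ ≡ 2 * y → (∣ A ∣ + h ∸ 1) C h ≡ 2 * q →
                    SumsetSize (2 * q) h A s → s < 2 * q
  sumset-not-full q h A y s ∣A∣-odd binomial≡ (S , ∈S⇔ , ∣S∣≡s) =
    ≤∧≢⇒< (subst (_≤ 2 * q) ∣S∣≡s (∣p∣≤n S)) λ s≡2q → invPow-nonzero e≢o h (begin
      invPow e o h                    ≡⟨ sym (S≗ h) ⟩
      signedSeries (2 * q) A toℕ h    ≡⟨ sym (signedSum-sums (2 * q) A toℕ h) ⟩
      signedSum (sums (2 * q) A toℕ h) ≡⟨ signedSum-covering q _ length≡ (covers (trans ∣S∣≡s s≡2q)) ⟩
      0ℤ                              ∎)
    where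
      open ≡-Reasoning
      decomposition = signedSeries-invPow (2 * q) A toℕ
      e = proj₁ decomposition
      o = proj₁ (proj₂ decomposition)
      e+o≡∣A∣ = proj₁ (proj₂ (proj₂ decomposition))
      S≗ = proj₂ (proj₂ (proj₂ decomposition))
      e≢o : e ≢ o
      e≢o e≡o = even≢odd y e (sym (begin
        suc (e + (e + 0)) ≡⟨ cong (λ x → suc (e + x)) (trans (+-identityʳ e) e≡o) ⟩
        suc (e + o)       ≡⟨ cong suc e+o≡∣A∣ ⟩
        suc ∣ A ∣         ≡⟨ ∣A∣-odd ⟩
        2 * y             ∎))
      length≡ : length (sums (2 * q) A toℕ h) ≡ 2 * q
      length≡ = ℤ.+-injective (begin
        + length (sums (2 * q) A toℕ h) ≡⟨ length-sums (2 * q) A toℕ h ⟩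
        fold 𝟙 geom⁺ ∣ A ∣ h            ≡⟨ geom⁺^-𝟙-binomial ∣ A ∣ h ⟩
        + ((∣ A ∣ + h ∸ 1) C h)         ≡⟨ cong +_ binomial≡ ⟩
        + (2 * q)                       ∎)
      covers : ∣ S ∣ ≡ 2 * q → Covers (2 * q) (sums (2 * q) A toℕ h)
      covers ∣S∣≡2q x =
        find (InSumset⇒sums (2 * q) h A x (Equivalence.to (∈S⇔ x) (subst (x ∈ₛ_) (sym (∣p∣≡n⇒p≡⊤ ∣S∣≡2q)) ∈⊤)))

  maximum-attained : ∀ n (g : Subset n → ℕ) → ∃ λ A → ∀ B → g B ≤ g A
  maximum-attained zero g = [] , λ { [] → ≤-refl }
  maximum-attained (suc n) g
    with maximum-attained n (g ∘ (inside ∷_)) | maximum-attained n (g ∘ (outside ∷_))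
  ... | A₁ , max₁ | A₀ , max₀ with g (outside ∷ A₀) ≤? g (inside ∷ A₁)
  ...   | yes g₀≤g₁ = inside ∷ A₁ , λ where
    (inside ∷ B) → max₁ B
    (outside ∷ B) → ≤-trans (max₀ B) g₀≤g₁
  ...   | no g₀≰g₁ = outside ∷ A₀ , λ where
    (inside ∷ B) → ≤-trans (max₁ B) (<⇒≤ (≰⇒> g₀≰g₁))
    (outside ∷ B) → max₀ B

  -- maximise the function that is 1 + g on P and 0 off P
  maximum-attained-on : ∀ {n} {P : Subset n → Set} → (∀ A → Dec (P A)) → ∃ P → (g : Subset n → ℕ) →
                        ∃ λ A → P A × ∀ B → P B → g B ≤ g A
  maximum-attained-on {n} {P} P? (A₀ , PA₀) g = A , PA , λ B PB →
    s≤s⁻¹ (subst₂ _≤_ (on-P (P? B) PB) (on-P (P? A) PA) (max B))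
    where
      lift : ∀ {B} → Dec (P B) → ℕ
      lift {B} (yes _) = suc (g B)
      lift (no _) = 0
      on-P : ∀ {B} (d : Dec (P B)) → P B → lift d ≡ suc (g B)
      on-P (yes _) _ = refl
      on-P (no ¬PB) PB = contradiction PB ¬PB
      A = proj₁ (maximum-attained n (lift ∘ P?))
      max = proj₂ (maximum-attained n (lift ∘ P?))
      positive⇒P : ∀ (d : Dec (P A)) → suc (g A₀) ≤ lift d → P A
      positive⇒P (yes PA) _ = PA
      PA : P A
      PA = positive⇒P (P? A) (subst (_≤ lift (P? A)) (on-P (P? A₀) PA₀) (max A₀))

  subset-of-size : ∀ {m n} → m ≤ n → ∃ λ (A : Subset n) → ∣ A ∣ ≡ m
  subset-of-size {n = zero} z≤n = [] , refl
  subset-of-size {zero} {suc n} z≤n = let A , ∣A∣≡0 = subset-of-size {n = n} z≤n in outside ∷ A , ∣A∣≡0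
  subset-of-size (s≤s m≤n) = let A , ∣A∣≡m = subset-of-size m≤n in inside ∷ A , cong suc ∣A∣≡m

  ν-exists : ∀ n m h → m ≤ n → ∃ λ v → IsNu n m h v
  ν-exists n m h m≤n = ∣ sumset n h A ∣ , (A , ∣A∣≡m , sumset-size n h A) ,
    λ B s ∣B∣≡m B-size → subst (_≤ ∣ sumset n h A ∣) (sym (SumsetSize-unique n h B s B-size)) (max B ∣B∣≡m)
    where
      maximal = maximum-attained-on (λ A → ∣ A ∣ ≟ m) (subset-of-size m≤n) (λ A → ∣ sumset n h A ∣)
      A = proj₁ maximal
      ∣A∣≡m = proj₁ (proj₂ maximal)
      max = proj₂ (proj₂ maximal)

  ν-below : ∀ q m h y → suc m ≡ 2 * y → (m + h ∸ 1) C h ≡ 2 * q → 1 ≤ h →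
            ∃ λ v → IsNu (2 * q) m h v × v < 2 * q
  ν-below q m (suc h) y m-odd binomial≡ _ with ν-exists (2 * q) m (suc h) m≤2q
    where
      m≤2q : m ≤ 2 * q
      m≤2q = subst (m ≤_) (trans (cong (λ x → (x ∸ 1) C suc h) (sym (+-suc m h))) binomial≡) (≤-binomial m h)
  ... | v , ν@((A , refl , A-size) , _) = v , ν , sumset-not-full q (suc h) A y v m-odd binomial≡ A-size

open BinomialParity using (binomial-even)
open Arithmetic using (<2^[1+⌊log2⌋])
open Sumsets using (ν-below)

open import Data.Nat using (ℕ; _+_; _*_; _∸_; _^_; _≤_; _<_; _⊓_; suc; s≤s; z≤n)
open import Data.Nat.Properties using (+-comm; *-assoc; *-mono-≤; m+[n∸m]≡n; ⊓-idem; m^n>0; ≤-trans)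
open import Data.Nat.Logarithm using (⌊log₂_⌋)
open import Data.Nat.Induction using (<-wellFounded)
open import Data.Nat.Combinatorics using (_C_)
open import Data.Product using (Σ; _×_; _,_)
open import Relation.Binary.PropositionalEquality

theorem1p5 : (k h : ℕ) → 1 ≤ k → 2 ≤ h →
    let m = 2 ^ (⌊log₂ h ⌋ + 1) * k ∸ 1
        n = (m + h ∸ 1) C h
    in Σ ℕ λ v → IsNu n m h v × (v < n ⊓ ((m + h ∸ 1) C h))
theorem1p5 k h 1≤k 2≤h =
  let q , n≡2q = binomial-even (suc t) k m h m+1≡2^[t+1]k 2≤h h<2^[t+1]
      v , ν , v<2q = ν-below q m h (2 ^ t * k) m+1≡2·2^tk n≡2q (≤-trans (s≤s z≤n) 2≤h)
  in v , subst (λ N → IsNu N m h v) (sym n≡2q) ν , subst (v <_) (sym (trans (⊓-idem _) n≡2q)) v<2q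
  where
    t = ⌊log₂ h ⌋
    m = 2 ^ (t + 1) * k ∸ 1
    m+1≡2^[t+1]k : suc m ≡ 2 ^ suc t * k
    m+1≡2^[t+1]k = trans (m+[n∸m]≡n (*-mono-≤ (m^n>0 2 (t + 1)) 1≤k)) (cong (λ e → 2 ^ e * k) (+-comm t 1))
    m+1≡2·2^tk : suc m ≡ 2 * (2 ^ t * k)
    m+1≡2·2^tk = trans m+1≡2^[t+1]k (*-assoc 2 (2 ^ t) k)
    h<2^[t+1] : h < 2 ^ suc t
    h<2^[t+1] = <2^[1+⌊log2⌋] h (<-wellFounded h)
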